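{- Let $k>1$ be a square-free integer, $f(x,y,z)=(x^2-ky^2)z-y+1$, and for a prime $p$ let $\sigma_p=\lim_{\ell\to\infty}p^{ -2\ell}\nu(p^\ell)$. Then \[\sigma_p=\begin{cases}1-\frac1{p^2}&\text{if }p>2\text{ and }(\frac kp)=-1,\\ 1+\frac1{p^2}&\text{if }p>2\text{ and }(\frac kp)=+1,\\ 1&\text{if }p\mid 2k.\end{cases}\]
   Context: $\nu(p^\ell)=\#\{\mathbf{x}\in(\mathbb{Z}/p^\ell\mathbb{Z})^3:f(\mathbf{x})\equiv0\bmod p^\ell\}$, and $(\frac{\cdot}{p})$ is the Legendre symbol. -}

module Defs where

open import Data.Bool using (Bool; true; false; if_then_else_)
open import Data.Nat as ℕ using (ℕ; zero; suc; NonZero; nonTrivial⇒nonZero)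
open import Data.Nat.Divisibility using (_∣_; _∣?_)
import Data.Nat.Properties as ℕP
open import Data.Nat.Primality using (Prime; prime)
open import Data.Fin using (Fin; toℕ)
open import Data.List using (List; map; upTo; allFin)
open import Data.Nat.ListAction using (sum)
open import Data.Bool.ListAction using (any)
open import Data.Integer as ℤ using (ℤ; +_; ∣_∣)
open import Data.Rational as ℚ using (ℚ; _/_; _<_; _-_)
open import Data.Product using (∃; Σ)
open import Relation.Nullary using (does)

SquareFree : ℕ → Set
SquareFree k = ∀ d → (d ℕ.* d) ∣ k → d ∣ 1

f : ℤ → ℤ → ℤ → ℤ → ℤ
f k x y z = ((x ℤ.* x ℤ.- k ℤ.* y ℤ.* y) ℤ.* z) ℤ.- y ℤ.+ ℤ.1ℤ

divides? : ℕ → ℤ → Bool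
divides? m a = does (m ∣? ∣ a ∣)

-- ν(m) = #{ (x,y,z) ∈ (ℤ/mℤ)³ : f(x,y,z) ≡ 0 mod m }, representatives 0..m-1
ν : ℤ → ℕ → ℕ
ν k m = sum (map (λ (x : Fin m) → sum (map (λ (y : Fin m) → sum (map (λ (z : Fin m) →
          if divides? m (f k (+ toℕ x) (+ toℕ y) (+ toℕ z)) then 1 else 0)
          (allFin m))) (allFin m))) (allFin m))

legendre : ℤ → ℕ → ℤ
legendre a p =
  if divides? p a then ℤ.0ℤ
  else (if any (λ x → divides? p ((+ x) ℤ.* (+ x) ℤ.- a)) (upTo p) then ℤ.1ℤ else ℤ.-1ℤ)

prime⇒nonZero : ∀ {p} → Prime p → NonZero p
prime⇒nonZero {p} (prime _) = nonTrivial⇒nonZero p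

σseq : (k : ℤ) (p : ℕ) → Prime p → ℕ → ℚ
σseq k p pp ℓ = _/_ (+ ν k (p ℕ.^ ℓ)) (p ℕ.^ (2 ℕ.* ℓ)) {{ℕP.m^n≢0 p (2 ℕ.* ℓ) {{prime⇒nonZero pp}}}}

invSq : (p : ℕ) → Prime p → ℚ
invSq p pp = _/_ ℤ.1ℤ (p ℕ.* p) {{ℕP.m*n≢0 p p {{prime⇒nonZero pp}} {{prime⇒nonZero pp}}}}

ConvergesTo : (ℕ → ℚ) → ℚ → Set
ConvergesTo a c = ∀ (ε : ℚ) → ℚ.0ℚ < ε → ∃ λ L → ∀ ℓ → L ℕ.≤ ℓ → ℚ.∣ a ℓ - c ∣ < ε

module Submission where

-- Write m = p^(n+1) and N = p^n, and count the zeros of f(x,y,z) = (x² − k y²) z − y + 1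
-- modulo m fibre by fibre over y.  If p ∣ y, then f ≡ 1 (mod p) when p ∣ x, while for p ∤ x
-- the coefficient x² − k y² is a unit and z is unique: N · N(p − 1) zeros in all.  If p ∤ y,
-- the substitution x = yX, z = y⁻² Z turns f into (X² − k) Z − (y − 1); summing over the
-- units y leaves the number of (X, Z) for which 1 + (X² − k) Z is a unit, which is
-- p-periodic and equals N² (p(p − 1) + r), where r is the number of square roots of k mod p.
-- Hence ν(p^(n+1)) = p^(2n) (p² − 1 + r), so p^(−2ℓ) ν(p^ℓ) = 1 + (r − 1)/p² for every
-- ℓ ≥ 1, and r = 0, 2, 1 in the three cases.

open import Data.Bool using (true; false; T; if_then_else_)
open import Data.Bool.ListAction using (any)
open import Data.Bool.Properties using (T-≡)
open import Data.Empty using (⊥-elim)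
open import Data.Fin as Fin using (Fin; toℕ)
open import Data.List using (map; allFin; tabulate; upTo)
open import Data.List.Membership.Propositional using (lose)
open import Data.List.Membership.Propositional.Properties using (∈-upTo⁺)
open import Data.List.Properties using (map-tabulate)
open import Data.List.Relation.Unary.Any using (satisfied)
open import Data.List.Relation.Unary.Any.Properties using (any⁺; any⁻)
open import Data.Nat as ℕ using (ℕ; zero; suc; NonZero; z<s; s<s; _^_)
open import Data.Nat.Coprimality using (Coprime; coprime-Bézout; coprime-divisor)
open import Data.Nat.Divisibility as ℕ∣ using (>⇒∤)
open import Data.Nat.GCD using (module Bézout)
open import Data.Nat.ListAction using (sum)
open import Data.Nat.Primality
  using (Prime; euclidsLemma; prime⇒irreducible; prime⇒nonTrivial; ¬prime[0]; ¬prime[1]; prime[2])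
import Data.Nat.Properties as ℕP
import Data.Nat.Tactic.RingSolver as ℕ-Ring
open import Data.Product using (∃; _×_; _,_; proj₁; proj₂)
open import Data.Rational as ℚ using (ℚ; 1ℚ; toℚᵘ)
import Data.Rational.Properties as ℚP
open import Data.Rational.Unnormalised as ℚᵘ using (mkℚᵘ; *≡*)
import Data.Rational.Unnormalised.Properties as ℚᵘP
open import Data.Sum using (_⊎_; inj₁; inj₂)
open import Function using (id; _∘_)
open import Function.Bundles using (Equivalence)
open import Relation.Binary.PropositionalEquality
open import Relation.Nullary using (¬_; yes; no)
open import Relation.Nullary.Decidable using (dec-true; dec-false)

open import Defs using (divides?; f; ν; legendre; σseq; invSq; ConvergesTo; SquareFree)

-- Sums over ranges

∑< : ℕ → (ℕ → ℕ) → ℕ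
∑< zero    g = 0
∑< (suc n) g = g 0 ℕ.+ ∑< n (g ∘ suc)

syntax ∑< n (λ i → e) = ∑[ i < n ] e

module _ where
  open import Data.Nat using (_+_; _*_; _<_)
  open import Algebra.Properties.CommutativeSemigroup ℕP.+-commutativeSemigroup using (interchange)
  open ≡-Reasoning

  ∑-cong : ∀ n {g h : ℕ → ℕ} → (∀ i → i < n → g i ≡ h i) → ∑< n g ≡ ∑< n h
  ∑-cong zero    g≗h = refl
  ∑-cong (suc n) g≗h = cong₂ _+_ (g≗h 0 z<s) (∑-cong n (λ i i<n → g≗h (suc i) (s<s i<n)))

  ∑-zero : ∀ n {g : ℕ → ℕ} → (∀ i → i < n → g i ≡ 0) → ∑< n g ≡ 0
  ∑-zero zero    g≗0 = refl
  ∑-zero (suc n) g≗0 = cong₂ _+_ (g≗0 0 z<s) (∑-zero n (λ i i<n → g≗0 (suc i) (s<s i<n)))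

  ∑-const : ∀ n c → ∑[ i < n ] c ≡ n * c
  ∑-const zero    c = refl
  ∑-const (suc n) c = cong (c +_) (∑-const n c)

  ∑-distrib-+ : ∀ n (g h : ℕ → ℕ) → ∑[ i < n ] (g i + h i) ≡ ∑< n g + ∑< n h
  ∑-distrib-+ zero    g h = refl
  ∑-distrib-+ (suc n) g h = begin
    g 0 + h 0 + ∑[ i < n ] (g (suc i) + h (suc i))  ≡⟨ cong (g 0 + h 0 +_) (∑-distrib-+ n (g ∘ suc) (h ∘ suc)) ⟩
    g 0 + h 0 + (∑< n (g ∘ suc) + ∑< n (h ∘ suc))    ≡⟨ interchange (g 0) (h 0) _ _ ⟩
    g 0 + ∑< n (g ∘ suc) + (h 0 + ∑< n (h ∘ suc))    ∎

  *-distribˡ-∑ : ∀ n c (g : ℕ → ℕ) → c * ∑< n g ≡ ∑[ i < n ] (c * g i)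
  *-distribˡ-∑ zero    c g = ℕP.*-zeroʳ c
  *-distribˡ-∑ (suc n) c g = trans (ℕP.*-distribˡ-+ c (g 0) _) (cong (c * g 0 +_) (*-distribˡ-∑ n c (g ∘ suc)))

  *-distribʳ-∑ : ∀ n c (g : ℕ → ℕ) → ∑< n g * c ≡ ∑[ i < n ] (g i * c)
  *-distribʳ-∑ n c g = begin
    ∑< n g * c               ≡⟨ ℕP.*-comm (∑< n g) c ⟩
    c * ∑< n g               ≡⟨ *-distribˡ-∑ n c g ⟩
    ∑[ i < n ] (c * g i)     ≡⟨ ∑-cong n (λ i _ → ℕP.*-comm c (g i)) ⟩
    ∑[ i < n ] (g i * c)     ∎

  ∑-comm : ∀ m n (g : ℕ → ℕ → ℕ) → ∑[ i < m ] ∑[ j < n ] g i j ≡ ∑[ j < n ] ∑[ i < m ] g i j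
  ∑-comm zero    n g = sym (∑-zero n (λ _ _ → refl))
  ∑-comm (suc m) n g = trans (cong (∑< n (g 0) +_) (∑-comm m n (g ∘ suc)))
                             (sym (∑-distrib-+ n (g 0) (λ j → ∑[ i < m ] g (suc i) j)))

  ∑-++ : ∀ a b (g : ℕ → ℕ) → ∑< (a + b) g ≡ ∑< a g + ∑[ i < b ] g (a + i)
  ∑-++ zero    b g = refl
  ∑-++ (suc a) b g = trans (cong (g 0 +_) (∑-++ a b (g ∘ suc))) (sym (ℕP.+-assoc (g 0) _ _))

  ∑-periodic : ∀ n p (g : ℕ → ℕ) → (∀ i → g (p + i) ≡ g i) → ∑< (n * p) g ≡ n * ∑< p g
  ∑-periodic zero    p g period = refl
  ∑-periodic (suc n) p g period = trans (∑-++ p (n * p) g)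
    (cong (∑< p g +_) (trans (∑-cong (n * p) (λ i _ → period i)) (∑-periodic n p g period)))

  ∑-single : ∀ n r {g : ℕ → ℕ} → r < n → (∀ i → i < n → i ≢ r → g i ≡ 0) → ∑< n g ≡ g r
  ∑-single (suc n) zero    {g} r<n g≗0 =
    trans (cong (g 0 +_) (∑-zero n (λ i i<n → g≗0 (suc i) (s<s i<n) λ ()))) (ℕP.+-identityʳ (g 0))
  ∑-single (suc n) (suc r) {g} (s<s r<n) g≗0 =
    cong₂ _+_ (g≗0 0 z<s λ ()) (∑-single n r r<n (λ i i<n i≢r → g≗0 (suc i) (s<s i<n) (i≢r ∘ ℕP.suc-injective)))

  sum-tabulate : ∀ n {G : Fin n → ℕ} (g : ℕ → ℕ) → (∀ i → G i ≡ g (toℕ i)) → sum (tabulate G) ≡ ∑< n g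
  sum-tabulate zero    g G≗g = refl
  sum-tabulate (suc n) g G≗g = cong₂ _+_ (G≗g Fin.zero) (sum-tabulate n (g ∘ suc) (G≗g ∘ Fin.suc))

  sum-allFin : ∀ n {G : Fin n → ℕ} (g : ℕ → ℕ) → (∀ i → G i ≡ g (toℕ i)) → sum (map G (allFin n)) ≡ ∑< n g
  sum-allFin n {G} g G≗g = trans (cong sum (map-tabulate id G)) (sum-tabulate n g G≗g)

-- Divisibility indicators

open import Data.Integer as ℤ using (ℤ; +_; -[1+_]; -_; _+_; _-_; _*_; 0ℤ; 1ℤ; -1ℤ)
open import Data.Integer.Divisibility.Signed
  using (_∣_; _∣?_; divides; ∣ᵤ⇒∣; ∣⇒∣ᵤ; ∣m∣n⇒∣m+n; ∣n⇒∣m*n; ∣-trans)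
open import Data.Integer.DivMod using (_%ℕ_; _/ℕ_; a≡a%ℕn+[a/ℕn]*n; n%ℕd<d)
import Data.Integer.Properties as ℤP
open import Data.Integer.Tactic.RingSolver using (solve-∀)

-- Opaque, so that an indicator is a rigid term for unification; 𝟙∣-unfold relates it to ν.
opaque
  𝟙[_∣_] : ℕ → ℤ → ℕ
  𝟙[ m ∣ a ] = if divides? m a then 1 else 0

  𝟙[_∤_] : ℕ → ℤ → ℕ
  𝟙[ m ∤ a ] = if divides? m a then 0 else 1

  𝟙∣-unfold : ∀ m a → 𝟙[ m ∣ a ] ≡ (if divides? m a then 1 else 0)
  𝟙∣-unfold m a = refl

  𝟙∣-yes : ∀ {m a} → + m ∣ a → 𝟙[ m ∣ a ] ≡ 1
  𝟙∣-yes {m} {a} m∣a rewrite dec-true (m ℕ∣.∣? ℤ.∣ a ∣) (∣⇒∣ᵤ m∣a) = refl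

  𝟙∣-no : ∀ {m a} → ¬ + m ∣ a → 𝟙[ m ∣ a ] ≡ 0
  𝟙∣-no {m} {a} m∤a rewrite dec-false (m ℕ∣.∣? ℤ.∣ a ∣) (m∤a ∘ ∣ᵤ⇒∣) = refl

  𝟙∤-yes : ∀ {m a} → ¬ + m ∣ a → 𝟙[ m ∤ a ] ≡ 1
  𝟙∤-yes {m} {a} m∤a rewrite dec-false (m ℕ∣.∣? ℤ.∣ a ∣) (m∤a ∘ ∣ᵤ⇒∣) = refl

  𝟙∤-no : ∀ {m a} → + m ∣ a → 𝟙[ m ∤ a ] ≡ 0
  𝟙∤-no {m} {a} m∣a rewrite dec-true (m ℕ∣.∣? ℤ.∣ a ∣) (∣⇒∣ᵤ m∣a) = refl

𝟙∤+𝟙∣≡1 : ∀ {m a} → 𝟙[ m ∤ a ] ℕ.+ 𝟙[ m ∣ a ] ≡ 1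
𝟙∤+𝟙∣≡1 {m} {a} with + m ∣? a
... | yes m∣a rewrite 𝟙∤-no m∣a | 𝟙∣-yes m∣a = refl
... | no  m∤a rewrite 𝟙∤-yes m∤a | 𝟙∣-no m∤a = refl

∑-𝟙∤+∑-𝟙∣ : ∀ n m (g : ℕ → ℤ) → ∑[ i < n ] 𝟙[ m ∤ g i ] ℕ.+ ∑[ i < n ] 𝟙[ m ∣ g i ] ≡ n
∑-𝟙∤+∑-𝟙∣ n m g = begin
  ∑[ i < n ] 𝟙[ m ∤ g i ] ℕ.+ ∑[ i < n ] 𝟙[ m ∣ g i ]  ≡⟨ ∑-distrib-+ n _ _ ⟨
  ∑[ i < n ] (𝟙[ m ∤ g i ] ℕ.+ 𝟙[ m ∣ g i ])           ≡⟨ ∑-cong n (λ i _ → 𝟙∤+𝟙∣≡1 {m} {g i}) ⟩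
  ∑[ i < n ] 1                                         ≡⟨ ∑-const n 1 ⟩
  n ℕ.* 1                                              ≡⟨ ℕP.*-identityʳ n ⟩
  n                                                    ∎
  where open ≡-Reasoning

∣-multiple : ∀ {d a c} x → c ≡ x * a → d ∣ a → d ∣ c
∣-multiple x refl d∣a = ∣n⇒∣m*n x d∣a

∣-linear : ∀ {d a b c} x y → c ≡ x * a + y * b → d ∣ a → d ∣ b → d ∣ c
∣-linear x y refl d∣a d∣b = ∣m∣n⇒∣m+n (∣n⇒∣m*n x d∣a) (∣n⇒∣m*n y d∣b)

∣a-b∧∣a⇒∣b : ∀ {d a b} → d ∣ a - b → d ∣ a → d ∣ b
∣a-b∧∣a⇒∣b {a = a} {b} d∣a-b d∣a = ∣-linear 1ℤ (- 1ℤ) (identity a b) d∣a d∣a-b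
  where identity : ∀ a b → b ≡ 1ℤ * a + - 1ℤ * (a - b)
        identity = solve-∀

∣a-b∧∣b⇒∣a : ∀ {d a b} → d ∣ a - b → d ∣ b → d ∣ a
∣a-b∧∣b⇒∣a {a = a} {b} d∣a-b d∣b = ∣-linear 1ℤ 1ℤ (identity a b) d∣b d∣a-b
  where identity : ∀ a b → a ≡ 1ℤ * b + 1ℤ * (a - b)
        identity = solve-∀

𝟙∣-⇔ : ∀ {m a b} → (+ m ∣ a → + m ∣ b) → (+ m ∣ b → + m ∣ a) → 𝟙[ m ∣ a ] ≡ 𝟙[ m ∣ b ]
𝟙∣-⇔ {m} {a} to from with + m ∣? a
... | yes m∣a = trans (𝟙∣-yes m∣a) (sym (𝟙∣-yes (to m∣a)))
... | no  m∤a = trans (𝟙∣-no m∤a) (sym (𝟙∣-no (m∤a ∘ from)))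

𝟙∣-mod : ∀ {m a b} → + m ∣ a - b → 𝟙[ m ∣ a ] ≡ 𝟙[ m ∣ b ]
𝟙∣-mod {a = a} {b} m∣a-b = 𝟙∣-⇔ (∣a-b∧∣a⇒∣b {a = a} {b} m∣a-b) (∣a-b∧∣b⇒∣a m∣a-b)

𝟙∤-mod : ∀ {m a b} → + m ∣ a - b → 𝟙[ m ∤ a ] ≡ 𝟙[ m ∤ b ]
𝟙∤-mod {m} {a} {b} m∣a-b with + m ∣? a
... | yes m∣a = trans (𝟙∤-no m∣a) (sym (𝟙∤-no (∣a-b∧∣a⇒∣b m∣a-b m∣a)))
... | no  m∤a = trans (𝟙∤-yes m∤a) (sym (𝟙∤-yes (m∤a ∘ ∣a-b∧∣b⇒∣a m∣a-b)))

residue-unique : ∀ {m r s} → r ℕ.< m → s ℕ.< m → + m ∣ + r - + s → r ≡ s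
residue-unique {m} {r} {s} r<m s<m m∣r-s =
  ℤP.+-injective (ℤP.i-j≡0⇒i≡j (+ r) (+ s) (ℤP.∣i∣≡0⇒i≡0 (multiple<⇒≡0 ∣r-s∣<m (∣⇒∣ᵤ m∣r-s))))
  where
  multiple<⇒≡0 : ∀ {k} → k ℕ.< m → m ℕ∣.∣ k → k ≡ 0
  multiple<⇒≡0 {zero}  _   _   = refl
  multiple<⇒≡0 {suc k} k<m m∣k = ⊥-elim (>⇒∤ k<m m∣k)
  ∣r-s∣<m : ℤ.∣ + r - + s ∣ ℕ.< m
  ∣r-s∣<m = begin-strict
    ℤ.∣ + r - + s ∣  ≡⟨ cong ℤ.∣_∣ (ℤP.m-n≡m⊖n r s) ⟩
    ℤ.∣ r ℤ.⊖ s ∣    ≤⟨ ℤP.∣m⊝n∣≤m⊔n r s ⟩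
    r ℕ.⊔ s          <⟨ ℕP.⊔-lub r<m s<m ⟩
    m                ∎
    where open ℕP.≤-Reasoning

-- Sums of functions of residues

InvariantMod : ℕ → (ℤ → ℕ) → Set
InvariantMod m G = ∀ a b → + m ∣ a - b → G a ≡ G b

InverseMod : ℕ → ℤ → ℤ → Set
InverseMod m u v = + m ∣ u * v - 1ℤ

∑-mod-periodic : ∀ N q (G : ℤ → ℕ) → InvariantMod q G → ∑[ i < N ℕ.* q ] G (+ i) ≡ N ℕ.* ∑[ i < q ] G (+ i)
∑-mod-periodic N q G G-inv = ∑-periodic N q (λ i → G (+ i)) (λ i → G-inv (+ (q ℕ.+ i)) (+ i) (divides 1ℤ (q+i-i≡q i)))
  where
  identity : ∀ q i → q + i - i ≡ 1ℤ * q
  identity = solve-∀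
  q+i-i≡q : ∀ i → + (q ℕ.+ i) - + i ≡ 1ℤ * + q
  q+i-i≡q i = trans (cong (_- + i) (ℤP.pos-+ q i)) (identity (+ q) (+ i))

module _ (m : ℕ) .{{_ : NonZero m}} where
  open ≡-Reasoning

  ∑-sift : ∀ a (G : ℤ → ℕ) → InvariantMod m G → ∑[ j < m ] (𝟙[ m ∣ a - + j ] ℕ.* G (+ j)) ≡ G a
  ∑-sift a G G-inv = begin
    ∑[ j < m ] (𝟙[ m ∣ a - + j ] ℕ.* G (+ j))  ≡⟨ ∑-single m r (n%ℕd<d a m) other-terms ⟩
    𝟙[ m ∣ a - + r ] ℕ.* G (+ r)               ≡⟨ cong (ℕ._* G (+ r)) (𝟙∣-yes (divides q a-r≡q*m)) ⟩
    G (+ r) ℕ.+ 0                              ≡⟨ ℕP.+-identityʳ (G (+ r)) ⟩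
    G (+ r)                                    ≡⟨ G-inv (+ r) a (divides (- q) r-a≡-q*m) ⟩
    G a                                        ∎
    where
    r = a %ℕ m
    q = a /ℕ m
    a-r≡q*m : a - + r ≡ q * + m
    a-r≡q*m = trans (cong (_- + r) (a≡a%ℕn+[a/ℕn]*n a m)) (identity (+ r) (q * + m))
      where identity : ∀ r s → r + s - r ≡ s
            identity = solve-∀
    r-a≡-q*m : + r - a ≡ - q * + m
    r-a≡-q*m = trans (cong (λ t → + r - t) (a≡a%ℕn+[a/ℕn]*n a m)) (identity (+ r) q (+ m))
      where identity : ∀ r q m → r - (r + q * m) ≡ - q * m
            identity = solve-∀
    other-terms : ∀ i → i ℕ.< m → i ≢ r → 𝟙[ m ∣ a - + i ] ℕ.* G (+ i) ≡ 0
    other-terms i i<m i≢r with + m ∣? a - + i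
    ... | yes m∣a-i = ⊥-elim (i≢r (sym (residue-unique (n%ℕd<d a m) i<m m∣r-i)))
      where
      identity : ∀ a r i → r - i ≡ 1ℤ * (a - i) + - 1ℤ * (a - r)
      identity = solve-∀
      m∣r-i = ∣-linear 1ℤ (- 1ℤ) (identity a (+ r) (+ i)) m∣a-i (divides q a-r≡q*m)
    ... | no  m∤a-i = cong (ℕ._* G (+ i)) (𝟙∣-no m∤a-i)

  ∑-𝟙∣-unit : ∀ {u v} → InverseMod m u v → ∀ b → ∑[ x < m ] 𝟙[ m ∣ u * + x - b ] ≡ 1
  ∑-𝟙∣-unit {u} {v} uv≡1 b = trans (∑-cong m (λ x _ → solve-for x)) (∑-sift (v * b) (λ _ → 1) (λ _ _ _ → refl))
    where
    to : ∀ u v b x → v * b - x ≡ - v * (u * x - b) + x * (u * v - 1ℤ)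
    to = solve-∀
    from : ∀ u v b x → u * x - b ≡ - u * (v * b - x) + b * (u * v - 1ℤ)
    from = solve-∀
    solve-for : ∀ x → 𝟙[ m ∣ u * + x - b ] ≡ 𝟙[ m ∣ v * b - + x ] ℕ.* 1
    solve-for x = trans (𝟙∣-⇔ (λ m∣ux-b → ∣-linear (- v) (+ x) (to u v b (+ x)) m∣ux-b uv≡1)
                              (λ m∣vb-x → ∣-linear (- u) b (from u v b (+ x)) m∣vb-x uv≡1))
                        (sym (ℕP.*-identityʳ _))

  ∑-𝟙∣-translate : ∀ b → ∑[ x < m ] 𝟙[ m ∣ + x - b ] ≡ 1
  ∑-𝟙∣-translate b = trans (∑-cong m (λ x _ → cong (λ t → 𝟙[ m ∣ t - b ]) (sym (ℤP.*-identityˡ (+ x)))))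
                           (∑-𝟙∣-unit {1ℤ} {1ℤ} (divides 0ℤ refl) b)

  ∑-scale-unit : ∀ {u v} → InverseMod m u v → (G : ℤ → ℕ) → InvariantMod m G →
                 ∑[ x < m ] G (u * + x) ≡ ∑[ x < m ] G (+ x)
  ∑-scale-unit {u} uv≡1 G G-inv = begin
    ∑[ x < m ] G (u * + x)
      ≡⟨ ∑-cong m (λ x _ → sym (∑-sift (u * + x) G G-inv)) ⟩
    ∑[ x < m ] ∑[ y < m ] (𝟙[ m ∣ u * + x - + y ] ℕ.* G (+ y))
      ≡⟨ ∑-comm m m _ ⟩
    ∑[ y < m ] ∑[ x < m ] (𝟙[ m ∣ u * + x - + y ] ℕ.* G (+ y))
      ≡⟨ ∑-cong m (λ y _ → sym (*-distribʳ-∑ m (G (+ y)) _)) ⟩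
    ∑[ y < m ] (∑[ x < m ] 𝟙[ m ∣ u * + x - + y ] ℕ.* G (+ y))
      ≡⟨ ∑-cong m (λ y _ → cong (ℕ._* G (+ y)) (∑-𝟙∣-unit {u} uv≡1 (+ y))) ⟩
    ∑[ y < m ] (1 ℕ.* G (+ y))
      ≡⟨ ∑-cong m (λ y _ → ℕP.*-identityˡ (G (+ y))) ⟩
    ∑[ y < m ] G (+ y)
      ∎

-- Inverses modulo prime powers

pos-1+*≡* : ∀ {a b c d} → 1 ℕ.+ a ℕ.* b ≡ c ℕ.* d → 1ℤ + + a * + b ≡ + c * + d
pos-1+*≡* {a} {b} {c} {d} eq =
  trans (cong (λ t → 1ℤ + t) (sym (ℤP.pos-* a b))) (trans (cong +_ eq) (ℤP.pos-* c d))

coprime⇒inverseMod : ∀ {M n} → Coprime n M → ∃ (InverseMod M (+ n))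
coprime⇒inverseMod {M} {n} n⊥M with coprime-Bézout n⊥M
... | Bézout.+- x y 1+yM≡xn = + x , divides (+ y) (begin
  + n * + x - 1ℤ       ≡⟨ cong (_- 1ℤ) (ℤP.*-comm (+ n) (+ x)) ⟩
  + x * + n - 1ℤ       ≡⟨ cong (_- 1ℤ) (pos-1+*≡* {y} {M} {x} {n} 1+yM≡xn) ⟨
  1ℤ + + y * + M - 1ℤ  ≡⟨ identity (+ y * + M) ⟩
  + y * + M            ∎)
  where open ≡-Reasoning
        identity : ∀ t → 1ℤ + t - 1ℤ ≡ t
        identity = solve-∀
... | Bézout.-+ x y 1+xn≡yM = - + x , divides (- + y) (begin
  + n * - + x - 1ℤ     ≡⟨ identity (+ n) (+ x) ⟩
  - (1ℤ + + x * + n)   ≡⟨ cong -_ (pos-1+*≡* {x} {n} {y} {M} 1+xn≡yM) ⟩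
  - (+ y * + M)        ≡⟨ ℤP.neg-distribˡ-* (+ y) (+ M) ⟩
  - + y * + M          ∎)
  where open ≡-Reasoning
        identity : ∀ n x → n * - x - 1ℤ ≡ - (1ℤ + x * n)
        identity = solve-∀

module _ {p : ℕ} (pp : Prime p) where

  euclidsLemmaℤ : ∀ a b → + p ∣ a * b → + p ∣ a ⊎ + p ∣ b
  euclidsLemmaℤ a b p∣ab with euclidsLemma ℤ.∣ a ∣ ℤ.∣ b ∣ pp (subst (p ℕ∣.∣_) (ℤP.abs-* a b) (∣⇒∣ᵤ p∣ab))
  ... | inj₁ p∣a = inj₁ (∣ᵤ⇒∣ p∣a)
  ... | inj₂ p∣b = inj₂ (∣ᵤ⇒∣ p∣b)

  ∤⇒coprime-^ : ∀ {n} → ¬ p ℕ∣.∣ n → ∀ ℓ → Coprime n (p ^ ℓ)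
  ∤⇒coprime-^ p∤n zero    (_ , i∣1) = ℕ∣.∣1⇒≡1 i∣1
  ∤⇒coprime-^ p∤n (suc ℓ) {i} (i∣n , i∣p*pˡ) = ∤⇒coprime-^ p∤n ℓ (i∣n , coprime-divisor i⊥p i∣p*pˡ)
    where
    i⊥p : Coprime i p
    i⊥p (j∣i , j∣p) with prime⇒irreducible pp j∣p
    ... | inj₁ j≡1  = j≡1
    ... | inj₂ refl = ⊥-elim (p∤n (ℕ∣.∣-trans j∣i i∣n))

  ∤⇒inverseMod-^ : ∀ ℓ {a} → ¬ + p ∣ a → ∃ (InverseMod (p ^ ℓ) a)
  ∤⇒inverseMod-^ ℓ {+ n}       p∤a = coprime⇒inverseMod (∤⇒coprime-^ (p∤a ∘ ∣ᵤ⇒∣) ℓ)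
  ∤⇒inverseMod-^ ℓ { -[1+ n ]} p∤a with coprime⇒inverseMod (∤⇒coprime-^ (p∤a ∘ ∣ᵤ⇒∣) ℓ)
  ... | v , nv≡1 = - v , subst (+ (p ^ ℓ) ∣_) (identity (+ suc n) v) nv≡1
    where identity : ∀ a v → a * v - 1ℤ ≡ - a * - v - 1ℤ
          identity = solve-∀

-- Counting modulo a prime

#squareRoots : ℤ → ℕ → ℕ
#squareRoots K p = ∑[ x < p ] 𝟙[ p ∣ + x * + x - K ]

module _ {p′ : ℕ} (pp : Prime (suc p′)) where
  private
    p : ℕ
    p = suc p′
  open ≡-Reasoning

  p∤1 : ¬ + p ∣ 1ℤ
  p∤1 p∣1 = ℕ.nonTrivial⇒≢1 {{prime⇒nonTrivial pp}} (ℕ∣.∣1⇒≡1 (∣⇒∣ᵤ p∣1))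

  ∤⇒inverseMod : ∀ {a} → ¬ + p ∣ a → ∃ (InverseMod p a)
  ∤⇒inverseMod {a} p∤a = subst (λ q → ∃ (InverseMod q a)) (ℕP.*-identityʳ p) (∤⇒inverseMod-^ pp 1 p∤a)

  ∑-𝟙∣-residues : ∑[ i < p ] 𝟙[ p ∣ + i ] ≡ 1
  ∑-𝟙∣-residues = trans (∑-cong p (λ i _ → cong (λ t → 𝟙[ p ∣ t ]) (sym (ℤP.+-identityʳ (+ i)))))
                        (∑-𝟙∣-translate p 0ℤ)

  ∑-𝟙∤-residues : ∑[ i < p ] 𝟙[ p ∤ + i ] ≡ p′
  ∑-𝟙∤-residues = ℕP.+-cancelʳ-≡ 1 _ p′ (begin
    S ℕ.+ 1                               ≡⟨ cong (S ℕ.+_) ∑-𝟙∣-residues ⟨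
    S ℕ.+ ∑[ i < p ] 𝟙[ p ∣ + i ]         ≡⟨ ∑-𝟙∤+∑-𝟙∣ p p (λ i → + i) ⟩
    p                                     ≡⟨ ℕP.+-comm 1 p′ ⟩
    p′ ℕ.+ 1                              ∎)
    where S = ∑[ i < p ] 𝟙[ p ∤ + i ]

  ∑-𝟙∣-1+az : ∀ a → ∑[ z < p ] 𝟙[ p ∣ 1ℤ + a * + z ] ≡ 𝟙[ p ∤ a ]
  ∑-𝟙∣-1+az a with + p ∣? a
  ... | yes p∣a = trans (∑-zero p (λ z _ → 𝟙∣-no (p∤1 ∘ p∣1 z))) (sym (𝟙∤-no p∣a))
    where
    identity : ∀ a z → 1ℤ ≡ 1ℤ * (1ℤ + a * z) + - z * a
    identity = solve-∀
    p∣1 : ∀ z → + p ∣ 1ℤ + a * + z → + p ∣ 1ℤ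
    p∣1 z p∣1+az = ∣-linear 1ℤ (- + z) (identity a (+ z)) p∣1+az p∣a
  ... | no p∤a = begin
    ∑[ z < p ] 𝟙[ p ∣ 1ℤ + a * + z ]    ≡⟨ ∑-cong p (λ z _ → cong (λ t → 𝟙[ p ∣ t ]) (identity a (+ z))) ⟩
    ∑[ z < p ] 𝟙[ p ∣ a * + z - - 1ℤ ]  ≡⟨ ∑-𝟙∣-unit p {a} (proj₂ (∤⇒inverseMod {a} p∤a)) (- 1ℤ) ⟩
    1                                    ≡⟨ 𝟙∤-yes p∤a ⟨
    𝟙[ p ∤ a ]                           ∎
    where
    identity : ∀ a z → 1ℤ + a * z ≡ a * z - - 1ℤ
    identity = solve-∀

  ∑-𝟙∤-1+az : ∀ a → ∑[ z < p ] 𝟙[ p ∤ 1ℤ + a * + z ] ≡ p′ ℕ.+ 𝟙[ p ∣ a ]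
  ∑-𝟙∤-1+az a = ℕP.+-cancelʳ-≡ 1 _ _ (begin
    S ℕ.+ 1                               ≡⟨ cong (S ℕ.+_) (𝟙∤+𝟙∣≡1 {p} {a}) ⟨
    S ℕ.+ (𝟙[ p ∤ a ] ℕ.+ 𝟙[ p ∣ a ])     ≡⟨ ℕP.+-assoc S _ _ ⟨
    S ℕ.+ 𝟙[ p ∤ a ] ℕ.+ 𝟙[ p ∣ a ]       ≡⟨ cong (λ t → S ℕ.+ t ℕ.+ 𝟙[ p ∣ a ]) (∑-𝟙∣-1+az a) ⟨
    S ℕ.+ ∑[ z < p ] 𝟙[ p ∣ 1ℤ + a * + z ] ℕ.+ 𝟙[ p ∣ a ]
                                          ≡⟨ cong (ℕ._+ 𝟙[ p ∣ a ]) (∑-𝟙∤+∑-𝟙∣ p p (λ z → 1ℤ + a * + z)) ⟩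
    p ℕ.+ 𝟙[ p ∣ a ]                      ≡⟨ ℕP.+-comm 1 (p′ ℕ.+ 𝟙[ p ∣ a ]) ⟩
    p′ ℕ.+ 𝟙[ p ∣ a ] ℕ.+ 1               ∎)
    where S = ∑[ z < p ] 𝟙[ p ∤ 1ℤ + a * + z ]

  ∑∑-𝟙∤-1+[x²-K]z : ∀ K → ∑[ x < p ] ∑[ z < p ] 𝟙[ p ∤ 1ℤ + (+ x * + x - K) * + z ]
                           ≡ p ℕ.* p′ ℕ.+ #squareRoots K p
  ∑∑-𝟙∤-1+[x²-K]z K = begin
    ∑[ x < p ] ∑[ z < p ] 𝟙[ p ∤ 1ℤ + (+ x * + x - K) * + z ]
      ≡⟨ ∑-cong p (λ x _ → ∑-𝟙∤-1+az (+ x * + x - K)) ⟩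
    ∑[ x < p ] (p′ ℕ.+ 𝟙[ p ∣ + x * + x - K ])
      ≡⟨ ∑-distrib-+ p (λ _ → p′) (λ x → 𝟙[ p ∣ + x * + x - K ]) ⟩
    ∑[ x < p ] p′ ℕ.+ #squareRoots K p
      ≡⟨ cong (ℕ._+ #squareRoots K p) (∑-const p p′) ⟩
    p ℕ.* p′ ℕ.+ #squareRoots K p
      ∎

-- Counting modulo a prime power

module PrimePowerCount (K : ℤ) {p′ : ℕ} (pp : Prime (suc p′)) (n : ℕ) where
  private
    p N m : ℕ
    p = suc p′
    N = p ^ n
    m = p ^ suc n
    instance
      N≢0 : NonZero N
      N≢0 = ℕP.m^n≢0 p n
      m≢0 : NonZero m
      m≢0 = ℕP.m^n≢0 p (suc n)
  open ≡-Reasoning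

  #[X²-K]Z≡_ : ℤ → ℕ
  #[X²-K]Z≡ c = ∑[ X < m ] ∑[ Z < m ] 𝟙[ m ∣ (+ X * + X - K) * + Z - c ]

  m∣⇒p∣ : ∀ {a} → + m ∣ a → + p ∣ a
  m∣⇒p∣ = ∣-trans (∣ᵤ⇒∣ (ℕ∣.m∣m*n N))

  𝟙∤-invariantMod-m : InvariantMod m (λ a → 𝟙[ p ∤ a ])
  𝟙∤-invariantMod-m a b m∣a-b = 𝟙∤-mod (m∣⇒p∣ m∣a-b)

  ∑-mod-p : (G : ℤ → ℕ) → InvariantMod p G → ∑[ i < m ] G (+ i) ≡ N ℕ.* ∑[ i < p ] G (+ i)
  ∑-mod-p G G-inv = trans (cong (λ t → ∑[ i < t ] G (+ i)) (ℕP.*-comm p N)) (∑-mod-periodic N p G G-inv)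

  #multiples : ∑[ i < m ] 𝟙[ p ∣ + i ] ≡ N
  #multiples = begin
    ∑[ i < m ] 𝟙[ p ∣ + i ]      ≡⟨ ∑-mod-p (λ a → 𝟙[ p ∣ a ]) (λ a b → 𝟙∣-mod) ⟩
    N ℕ.* ∑[ i < p ] 𝟙[ p ∣ + i ] ≡⟨ cong (N ℕ.*_) (∑-𝟙∣-residues pp) ⟩
    N ℕ.* 1                      ≡⟨ ℕP.*-identityʳ N ⟩
    N                            ∎

  #units : ∑[ i < m ] 𝟙[ p ∤ + i ] ≡ N ℕ.* p′
  #units = trans (∑-mod-p (λ a → 𝟙[ p ∤ a ]) (λ a b → 𝟙∤-mod)) (cong (N ℕ.*_) (∑-𝟙∤-residues pp))

  fibre-over-p∣y : ∀ x y → + p ∣ + y → ∑[ z < m ] 𝟙[ m ∣ f K (+ x) (+ y) (+ z) ] ≡ 𝟙[ p ∤ + x ]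
  fibre-over-p∣y x y p∣y with + p ∣? + x
  ... | yes p∣x = trans (∑-zero m (λ z _ → 𝟙∣-no (p∤1 pp ∘ p∣f⇒p∣1 z ∘ m∣⇒p∣))) (sym (𝟙∤-no p∣x))
    where
    q = + x * + x - K * + y * + y
    p∣q : + p ∣ q
    p∣q = ∣-linear (+ x) (- (K * + y)) (identity (+ x) (+ y) K) p∣x p∣y
      where identity : ∀ x y K → x * x - K * y * y ≡ x * x + - (K * y) * y
            identity = solve-∀
    p∣f⇒p∣1 : ∀ z → + p ∣ f K (+ x) (+ y) (+ z) → + p ∣ 1ℤ
    p∣f⇒p∣1 z p∣f = ∣-linear 1ℤ (- 1ℤ) (identity q (+ y) (+ z)) p∣f p∣qz-y
      where identity : ∀ q y z → 1ℤ ≡ 1ℤ * (q * z - y + 1ℤ) + - 1ℤ * (q * z - y)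
            identity = solve-∀
            identity′ : ∀ q y z → q * z - y ≡ z * q + - 1ℤ * y
            identity′ = solve-∀
            p∣qz-y = ∣-linear (+ z) (- 1ℤ) (identity′ q (+ y) (+ z)) p∣q p∣y
  ... | no p∤x = begin
    ∑[ z < m ] 𝟙[ m ∣ f K (+ x) (+ y) (+ z) ]
      ≡⟨ ∑-cong m (λ z _ → cong (λ t → 𝟙[ m ∣ t ]) (identity q (+ y) (+ z))) ⟩
    ∑[ z < m ] 𝟙[ m ∣ q * + z - (+ y - 1ℤ) ]
      ≡⟨ ∑-𝟙∣-unit m {q} (proj₂ (∤⇒inverseMod-^ pp (suc n) p∤q)) (+ y - 1ℤ) ⟩
    1
      ≡⟨ 𝟙∤-yes p∤x ⟨
    𝟙[ p ∤ + x ]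
      ∎
    where
    q = + x * + x - K * + y * + y
    identity : ∀ q y z → q * z - y + 1ℤ ≡ q * z - (y - 1ℤ)
    identity = solve-∀
    p∤q : ¬ + p ∣ q
    p∤q p∣q with euclidsLemmaℤ pp (+ x) (+ x) (∣-linear 1ℤ (K * + y) (identity′ (+ x) (+ y) K) p∣q p∣y)
      where identity′ : ∀ x y K → x * x ≡ 1ℤ * (x * x - K * y * y) + (K * y) * y
            identity′ = solve-∀
    ... | inj₁ p∣x = p∤x p∣x
    ... | inj₂ p∣x = p∤x p∣x

  fibre-over-p∤y : ∀ y → ¬ + p ∣ + y →
    ∑[ x < m ] ∑[ z < m ] 𝟙[ m ∣ f K (+ x) (+ y) (+ z) ] ≡ #[X²-K]Z≡ (+ y - 1ℤ)
  fibre-over-p∤y y p∤y = begin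
    ∑[ x < m ] fibre (+ x)
      ≡⟨ ∑-scale-unit m {+ y} yv≡1 fibre fibre-invariant ⟨
    ∑[ X < m ] fibre (+ y * + X)
      ≡⟨ ∑-cong m (λ X _ → ∑-scale-unit m {v * v} v²y²≡1 _ (term-invariant X)) ⟨
    ∑[ X < m ] ∑[ Z < m ] 𝟙[ m ∣ f K (+ y * + X) (+ y) (v * v * + Z) ]
      ≡⟨ ∑-cong m (λ X _ → ∑-cong m (λ Z _ → 𝟙∣-mod (rescaled X Z))) ⟩
    #[X²-K]Z≡ (+ y - 1ℤ)
      ∎
    where
    v = proj₁ (∤⇒inverseMod-^ pp (suc n) p∤y)
    yv≡1 = proj₂ (∤⇒inverseMod-^ pp (suc n) p∤y)

    fibre : ℤ → ℕ
    fibre a = ∑[ z < m ] 𝟙[ m ∣ f K a (+ y) (+ z) ]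
    fibre-invariant : InvariantMod m fibre
    fibre-invariant a b m∣a-b = ∑-cong m (λ z _ → 𝟙∣-mod (∣-multiple ((a + b) * + z) (identity a b (+ y) (+ z) K) m∣a-b))
      where identity : ∀ a b y z K → ((a * a - K * y * y) * z - y + 1ℤ) - ((b * b - K * y * y) * z - y + 1ℤ)
                                      ≡ ((a + b) * z) * (a - b)
            identity = solve-∀

    term-invariant : ∀ X → InvariantMod m (λ c → 𝟙[ m ∣ f K (+ y * + X) (+ y) c ])
    term-invariant X c d m∣c-d = 𝟙∣-mod (∣-multiple (Q * Q - K * + y * + y) (identity Q (+ y) c d K) m∣c-d)
      where Q = + y * + X
            identity : ∀ Q y c d K → ((Q * Q - K * y * y) * c - y + 1ℤ) - ((Q * Q - K * y * y) * d - y + 1ℤ)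
                                    ≡ (Q * Q - K * y * y) * (c - d)
            identity = solve-∀

    v²y²≡1 : InverseMod m (v * v) (+ y * + y)
    v²y²≡1 = ∣-multiple (+ y * v + 1ℤ) (identity (+ y) v) yv≡1
      where identity : ∀ y v → v * v * (y * y) - 1ℤ ≡ (y * v + 1ℤ) * (y * v - 1ℤ)
            identity = solve-∀

    rescaled : ∀ X Z → + m ∣ f K (+ y * + X) (+ y) (v * v * + Z) - ((+ X * + X - K) * + Z - (+ y - 1ℤ))
    rescaled X Z = ∣-multiple ((+ X * + X - K) * + Z * (+ y * v + 1ℤ)) (identity (+ y) v (+ X) (+ Z) K) yv≡1
      where identity : ∀ y v X Z K → (((y * X) * (y * X) - K * y * y) * (v * v * Z) - y + 1ℤ) - ((X * X - K) * Z - (y - 1ℤ))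
                                    ≡ (X * X - K) * Z * (y * v + 1ℤ) * (y * v - 1ℤ)
            identity = solve-∀

  fibre-over-y : ∀ y → ∑[ x < m ] ∑[ z < m ] 𝟙[ m ∣ f K (+ x) (+ y) (+ z) ]
                       ≡ 𝟙[ p ∣ + y ] ℕ.* (N ℕ.* p′) ℕ.+ 𝟙[ p ∤ + y ] ℕ.* #[X²-K]Z≡ (+ y - 1ℤ)
  fibre-over-y y with + p ∣? + y
  ... | yes p∣y rewrite 𝟙∣-yes p∣y | 𝟙∤-no p∣y = begin
    ∑[ x < m ] ∑[ z < m ] 𝟙[ m ∣ f K (+ x) (+ y) (+ z) ]  ≡⟨ ∑-cong m (λ x _ → fibre-over-p∣y x y p∣y) ⟩
    ∑[ x < m ] 𝟙[ p ∤ + x ]                              ≡⟨ #units ⟩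
    N ℕ.* p′                                             ≡⟨ trans (ℕP.+-identityʳ _) (ℕP.+-identityʳ _) ⟨
    N ℕ.* p′ ℕ.+ 0 ℕ.+ 0                                 ∎
  ... | no p∤y rewrite 𝟙∣-no p∤y | 𝟙∤-yes p∤y = trans (fibre-over-p∤y y p∤y) (sym (ℕP.+-identityʳ _))

  ∑-units-#[X²-K]Z≡ : ∑[ y < m ] (𝟙[ p ∤ + y ] ℕ.* #[X²-K]Z≡ (+ y - 1ℤ))
                      ≡ ∑[ X < m ] ∑[ Z < m ] 𝟙[ p ∤ 1ℤ + (+ X * + X - K) * + Z ]
  ∑-units-#[X²-K]Z≡ = begin
    ∑[ y < m ] (𝟙[ p ∤ + y ] ℕ.* #[X²-K]Z≡ (+ y - 1ℤ))
      ≡⟨ ∑-cong m (λ y _ → trans (*-distribˡ-∑ m 𝟙[ p ∤ + y ] _)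
                                 (∑-cong m (λ X _ → *-distribˡ-∑ m 𝟙[ p ∤ + y ] (λ Z → 𝟙[ m ∣ E X Z - (+ y - 1ℤ) ])))) ⟩
    ∑[ y < m ] ∑[ X < m ] ∑[ Z < m ] (𝟙[ p ∤ + y ] ℕ.* 𝟙[ m ∣ E X Z - (+ y - 1ℤ) ])
      ≡⟨ ∑-comm m m _ ⟩
    ∑[ X < m ] ∑[ y < m ] ∑[ Z < m ] (𝟙[ p ∤ + y ] ℕ.* 𝟙[ m ∣ E X Z - (+ y - 1ℤ) ])
      ≡⟨ ∑-cong m (λ X _ → ∑-comm m m _) ⟩
    ∑[ X < m ] ∑[ Z < m ] ∑[ y < m ] (𝟙[ p ∤ + y ] ℕ.* 𝟙[ m ∣ E X Z - (+ y - 1ℤ) ])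
      ≡⟨ ∑-cong m (λ X _ → ∑-cong m (λ Z _ → ∑-cong m (λ y _ → reorder X Z y))) ⟩
    ∑[ X < m ] ∑[ Z < m ] ∑[ y < m ] (𝟙[ m ∣ 1ℤ + E X Z - + y ] ℕ.* 𝟙[ p ∤ + y ])
      ≡⟨ ∑-cong m (λ X _ → ∑-cong m (λ Z _ → ∑-sift m (1ℤ + E X Z) (λ a → 𝟙[ p ∤ a ]) 𝟙∤-invariantMod-m)) ⟩
    ∑[ X < m ] ∑[ Z < m ] 𝟙[ p ∤ 1ℤ + E X Z ]
      ∎
    where
    E : ℕ → ℕ → ℤ
    E X Z = (+ X * + X - K) * + Z
    identity : ∀ e y → e - (y - 1ℤ) ≡ 1ℤ + e - y
    identity = solve-∀
    reorder : ∀ X Z y → 𝟙[ p ∤ + y ] ℕ.* 𝟙[ m ∣ E X Z - (+ y - 1ℤ) ]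
                        ≡ 𝟙[ m ∣ 1ℤ + E X Z - + y ] ℕ.* 𝟙[ p ∤ + y ]
    reorder X Z y = trans (ℕP.*-comm 𝟙[ p ∤ + y ] _)
                          (cong (λ t → 𝟙[ m ∣ t ] ℕ.* 𝟙[ p ∤ + y ]) (identity (E X Z) (+ y)))

  ∑∑-reduce-mod-p : ∑[ X < m ] ∑[ Z < m ] 𝟙[ p ∤ 1ℤ + (+ X * + X - K) * + Z ]
                    ≡ N ℕ.* (N ℕ.* ∑[ X < p ] ∑[ Z < p ] 𝟙[ p ∤ 1ℤ + (+ X * + X - K) * + Z ])
  ∑∑-reduce-mod-p = begin
    ∑[ X < m ] ∑[ Z < m ] 𝟙[ p ∤ 1ℤ + (+ X * + X - K) * + Z ]
      ≡⟨ ∑-cong m (λ X _ → ∑-mod-p (term (+ X)) (term-invariant (+ X))) ⟩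
    ∑[ X < m ] (N ℕ.* row (+ X))
      ≡⟨ ∑-mod-p (λ a → N ℕ.* row a) (λ a b → cong (N ℕ.*_) ∘ row-invariant a b) ⟩
    N ℕ.* ∑[ X < p ] (N ℕ.* row (+ X))
      ≡⟨ cong (N ℕ.*_) (*-distribˡ-∑ p N (λ X → row (+ X))) ⟨
    N ℕ.* (N ℕ.* ∑[ X < p ] row (+ X))
      ∎
    where
    term : ℤ → ℤ → ℕ
    term a c = 𝟙[ p ∤ 1ℤ + (a * a - K) * c ]
    row : ℤ → ℕ
    row a = ∑[ Z < p ] term a (+ Z)
    term-invariant : ∀ a → InvariantMod p (term a)
    term-invariant a c d p∣c-d = 𝟙∤-mod (∣-multiple (a * a - K) (identity a c d K) p∣c-d)
      where identity : ∀ a c d K → 1ℤ + (a * a - K) * c - (1ℤ + (a * a - K) * d) ≡ (a * a - K) * (c - d)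
            identity = solve-∀
    row-invariant : InvariantMod p row
    row-invariant a b p∣a-b = ∑-cong p λ Z _ →
      𝟙∤-mod {a = 1ℤ + (a * a - K) * + Z} (∣-multiple ((a + b) * + Z) (identity a b (+ Z) K) p∣a-b)
      where identity : ∀ a b z K → 1ℤ + (a * a - K) * z - (1ℤ + (b * b - K) * z) ≡ (a + b) * z * (a - b)
            identity = solve-∀

  ν-prime-power : ν K m ≡ N ℕ.* N ℕ.* (p′ ℕ.* suc p ℕ.+ #squareRoots K p)
  ν-prime-power = begin
    ν K m
      ≡⟨ sum-allFin m _ (λ x → sum-allFin m _ (λ y → sum-allFin m _ (λ z → sym (𝟙∣-unfold m _)))) ⟩
    ∑[ x < m ] ∑[ y < m ] ∑[ z < m ] 𝟙[ m ∣ f K (+ x) (+ y) (+ z) ]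
      ≡⟨ ∑-comm m m _ ⟩
    ∑[ y < m ] ∑[ x < m ] ∑[ z < m ] 𝟙[ m ∣ f K (+ x) (+ y) (+ z) ]
      ≡⟨ ∑-cong m (λ y _ → fibre-over-y y) ⟩
    ∑[ y < m ] (𝟙[ p ∣ + y ] ℕ.* (N ℕ.* p′) ℕ.+ 𝟙[ p ∤ + y ] ℕ.* #[X²-K]Z≡ (+ y - 1ℤ))
      ≡⟨ ∑-distrib-+ m _ _ ⟩
    ∑[ y < m ] (𝟙[ p ∣ + y ] ℕ.* (N ℕ.* p′)) ℕ.+ ∑[ y < m ] (𝟙[ p ∤ + y ] ℕ.* #[X²-K]Z≡ (+ y - 1ℤ))
      ≡⟨ cong₂ ℕ._+_ (trans (sym (*-distribʳ-∑ m _ _)) (cong (ℕ._* (N ℕ.* p′)) #multiples))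
                     (trans ∑-units-#[X²-K]Z≡
                       (trans ∑∑-reduce-mod-p (cong (λ t → N ℕ.* (N ℕ.* t)) (∑∑-𝟙∤-1+[x²-K]z pp K)))) ⟩
    N ℕ.* (N ℕ.* p′) ℕ.+ N ℕ.* (N ℕ.* (p ℕ.* p′ ℕ.+ #squareRoots K p))
      ≡⟨ identity N p′ (#squareRoots K p) ⟩
    N ℕ.* N ℕ.* (p′ ℕ.* suc p ℕ.+ #squareRoots K p)
      ∎
    where
    identity : ∀ N p′ r → N ℕ.* (N ℕ.* p′) ℕ.+ N ℕ.* (N ℕ.* (suc p′ ℕ.* p′ ℕ.+ r))
                          ≡ N ℕ.* N ℕ.* (p′ ℕ.* suc (suc p′) ℕ.+ r)
    identity = ℕ-Ring.solve-∀

-- Square roots modulo p and the Legendre symbol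

divides?≡true⇒∣ : ∀ {m a} → divides? m a ≡ true → + m ∣ a
divides?≡true⇒∣ {m} {a} eq with m ℕ∣.∣? ℤ.∣ a ∣
divides?≡true⇒∣ eq  | yes m∣a = ∣ᵤ⇒∣ m∣a
divides?≡true⇒∣ ()  | no  _

divides?≡false⇒∤ : ∀ {m a} → divides? m a ≡ false → ¬ + m ∣ a
divides?≡false⇒∤ {m} {a} eq m∣a rewrite dec-true (m ℕ∣.∣? ℤ.∣ a ∣) (∣⇒∣ᵤ m∣a) with eq
... | ()

data LegendreView (K : ℤ) (p : ℕ) : ℤ → Set where
  ramified    : + p ∣ K → LegendreView K p 0ℤ
  residue     : ¬ + p ∣ K → ∀ x → + p ∣ + x * + x - K → LegendreView K p 1ℤ
  nonresidue  : ¬ + p ∣ K → (∀ x → x ℕ.< p → ¬ + p ∣ + x * + x - K) → LegendreView K p -1ℤ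

legendre-view : ∀ K p → LegendreView K p (legendre K p)
legendre-view K p with divides? p K in p∣?K
... | true  = ramified (divides?≡true⇒∣ p∣?K)
... | false with any (λ x → divides? p ((+ x) * (+ x) - K)) (upTo p) in any≡
...   | true  = residue (divides?≡false⇒∤ p∣?K) x (divides?≡true⇒∣ (Equivalence.to T-≡ isRoot))
  where
  root = satisfied (any⁻ (λ x → divides? p ((+ x) * (+ x) - K)) (upTo p) (Equivalence.from T-≡ any≡))
  x = proj₁ root
  isRoot = proj₂ root
...   | false = nonresidue (divides?≡false⇒∤ p∣?K) no-root
  where
  no-root : ∀ x → x ℕ.< p → ¬ + p ∣ + x * + x - K
  no-root x x<p p∣x²-K = subst T any≡ (any⁺ _ (lose (∈-upTo⁺ x<p) isRoot))
    where isRoot = Equivalence.from T-≡ (dec-true (p ℕ∣.∣? _) (∣⇒∣ᵤ p∣x²-K))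

legendre≡⇒view : ∀ {K p l} → legendre K p ≡ l → LegendreView K p l
legendre≡⇒view {K} {p} refl = legendre-view K p

#squareRoots-nonresidue : ∀ {K p} → LegendreView K p -1ℤ → #squareRoots K p ≡ 0
#squareRoots-nonresidue {p = p} (nonresidue _ no-root) = ∑-zero p (λ x x<p → 𝟙∣-no (no-root x x<p))

module _ {p′ : ℕ} (pp : Prime (suc p′)) {K : ℤ} where
  private
    p : ℕ
    p = suc p′

  #squareRoots-ramified : + p ∣ K → #squareRoots K p ≡ 1
  #squareRoots-ramified p∣K = trans (∑-cong p (λ x _ → 𝟙∣-⇔ (to x) (from x))) (∑-𝟙∣-translate p 0ℤ)
    where
    to : ∀ x → + p ∣ + x * + x - K → + p ∣ + x - 0ℤ
    to x p∣x²-K with euclidsLemmaℤ pp (+ x) (+ x) (∣-linear 1ℤ 1ℤ (identity (+ x) K) p∣x²-K p∣K)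
      where identity : ∀ x K → x * x ≡ 1ℤ * (x * x - K) + 1ℤ * K
            identity = solve-∀
    ... | inj₁ p∣x = subst (+ p ∣_) (sym (ℤP.+-identityʳ (+ x))) p∣x
    ... | inj₂ p∣x = subst (+ p ∣_) (sym (ℤP.+-identityʳ (+ x))) p∣x
    from : ∀ x → + p ∣ + x - 0ℤ → + p ∣ + x * + x - K
    from x p∣x = ∣-linear (+ x) (- 1ℤ) (identity (+ x) K) p∣x p∣K
      where identity : ∀ x K → x * x - K ≡ x * (x - 0ℤ) + - 1ℤ * K
            identity = solve-∀

  #squareRoots-residue : 2 ℕ.< p → LegendreView K p 1ℤ → #squareRoots K p ≡ 2
  #squareRoots-residue 2<p (residue p∤K x₀ p∣x₀²-K) = begin
    ∑[ x < p ] 𝟙[ p ∣ + x * + x - K ]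
      ≡⟨ ∑-cong p (λ x _ → two-roots (+ x)) ⟩
    ∑[ x < p ] (𝟙[ p ∣ + x - X₀ ] ℕ.+ 𝟙[ p ∣ + x - - X₀ ])
      ≡⟨ ∑-distrib-+ p (λ x → 𝟙[ p ∣ + x - X₀ ]) (λ x → 𝟙[ p ∣ + x - - X₀ ]) ⟩
    ∑[ x < p ] 𝟙[ p ∣ + x - X₀ ] ℕ.+ ∑[ x < p ] 𝟙[ p ∣ + x - - X₀ ]
      ≡⟨ cong₂ ℕ._+_ (∑-𝟙∣-translate p X₀) (∑-𝟙∣-translate p (- X₀)) ⟩
    2
      ∎
    where
    open ≡-Reasoning
    X₀ = + x₀
    p∤2x₀ : ¬ + p ∣ + 2 * X₀
    p∤2x₀ p∣2x₀ with euclidsLemmaℤ pp (+ 2) X₀ p∣2x₀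
    ... | inj₁ p∣2 = ℕP.<⇒≱ 2<p (ℕ∣.∣⇒≤ (∣⇒∣ᵤ p∣2))
    ... | inj₂ p∣x₀ = p∤K (∣-linear X₀ (- 1ℤ) (identity X₀ K) p∣x₀ p∣x₀²-K)
      where identity : ∀ x K → K ≡ x * x + - 1ℤ * (x * x - K)
            identity = solve-∀
    two-roots : ∀ x → 𝟙[ p ∣ x * x - K ] ≡ 𝟙[ p ∣ x - X₀ ] ℕ.+ 𝟙[ p ∣ x - - X₀ ]
    two-roots x with + p ∣? x - X₀ | + p ∣? x - - X₀
    ... | yes p∣x-x₀ | yes p∣x+x₀ = ⊥-elim (p∤2x₀ (∣-linear (- 1ℤ) 1ℤ (identity x X₀) p∣x-x₀ p∣x+x₀))
      where identity : ∀ x y → + 2 * y ≡ - 1ℤ * (x - y) + 1ℤ * (x - - y)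
            identity = solve-∀
    ... | yes p∣x-x₀ | no p∤x+x₀ rewrite 𝟙∣-yes p∣x-x₀ | 𝟙∣-no p∤x+x₀ =
      𝟙∣-yes (∣-linear (x + X₀) 1ℤ (identity x X₀ K) p∣x-x₀ p∣x₀²-K)
      where identity : ∀ x y K → x * x - K ≡ (x + y) * (x - y) + 1ℤ * (y * y - K)
            identity = solve-∀
    ... | no p∤x-x₀ | yes p∣x+x₀ rewrite 𝟙∣-no p∤x-x₀ | 𝟙∣-yes p∣x+x₀ =
      𝟙∣-yes (∣-linear (x - X₀) 1ℤ (identity x X₀ K) p∣x+x₀ p∣x₀²-K)
      where identity : ∀ x y K → x * x - K ≡ (x - y) * (x - - y) + 1ℤ * (y * y - K)
            identity = solve-∀
    ... | no p∤x-x₀ | no p∤x+x₀ rewrite 𝟙∣-no p∤x-x₀ | 𝟙∣-no p∤x+x₀ = 𝟙∣-no p∤x²-K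
      where
      identity : ∀ x y K → (x - y) * (x - - y) ≡ 1ℤ * (x * x - K) + - 1ℤ * (y * y - K)
      identity = solve-∀
      p∤x²-K : ¬ + p ∣ x * x - K
      p∤x²-K p∣x²-K
        with euclidsLemmaℤ pp (x - X₀) (x - - X₀) (∣-linear 1ℤ (- 1ℤ) (identity x X₀ K) p∣x²-K p∣x₀²-K)
      ... | inj₁ p∣x-x₀ = p∤x-x₀ p∣x-x₀
      ... | inj₂ p∣x+x₀ = p∤x+x₀ p∣x+x₀

#squareRoots-2 : ∀ {K} → ¬ + 2 ∣ K → #squareRoots K 2 ≡ 1
#squareRoots-2 {K} 2∤K = cong₂ ℕ._+_ (𝟙∣-no 2∤-K) (cong (ℕ._+ 0) (𝟙∣-yes 2∣1-K))
  where
  identity : ∀ K → K ≡ - 1ℤ * (0ℤ * 0ℤ - K)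
  identity = solve-∀
  2∤-K : ¬ + 2 ∣ 0ℤ * 0ℤ - K
  2∤-K 2∣-K = 2∤K (∣-multiple (- 1ℤ) (identity K) 2∣-K)
  2∣1-K : + 2 ∣ 1ℤ * 1ℤ - K
  2∣1-K with K %ℕ 2 | n%ℕd<d K 2 | a≡a%ℕn+[a/ℕn]*n K 2
  ... | 0 | _ | K≡2q = ⊥-elim (2∤K (divides (K /ℕ 2) (trans K≡2q (ℤP.+-identityˡ _))))
  ... | 1 | _ | K≡1+2q = divides (- (K /ℕ 2)) (trans (cong (λ t → 1ℤ * 1ℤ - t) K≡1+2q) (identity′ (K /ℕ 2)))
    where identity′ : ∀ q → 1ℤ * 1ℤ - (1ℤ + q * + 2) ≡ - q * + 2
          identity′ = solve-∀
  ... | suc (suc _) | s<s (s<s ()) | _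

#squareRoots-p∣2k : ∀ {p′ k} → Prime (suc p′) → suc p′ ℕ∣.∣ 2 ℕ.* k → #squareRoots (+ k) (suc p′) ≡ 1
#squareRoots-p∣2k {p′} {k} pp p∣2k with suc p′ ℕ∣.∣? k
... | yes p∣k = #squareRoots-ramified pp {+ k} (∣ᵤ⇒∣ p∣k)
... | no  p∤k with euclidsLemma 2 k pp p∣2k
...   | inj₂ p∣k = ⊥-elim (p∤k p∣k)
...   | inj₁ p∣2 with prime⇒irreducible prime[2] p∣2
...     | inj₁ refl = ⊥-elim (¬prime[1] pp)
...     | inj₂ refl = #squareRoots-2 {+ k} (p∤k ∘ ∣⇒∣ᵤ)

-- The local density

pos-*≡pos-* : ∀ {a b c d} → a ℕ.* b ≡ c ℕ.* d → + a * + b ≡ + c * + d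
pos-*≡pos-* {a} {b} {c} {d} eq = trans (sym (ℤP.pos-* a b)) (trans (cong +_ eq) (ℤP.pos-* c d))

/-cross : ∀ {i j} n d .{{_ : NonZero n}} .{{_ : NonZero d}} → i * + d ≡ j * + n → i ℚ./ n ≡ j ℚ./ d
/-cross {i} {j} (suc n) (suc d) eq = ℚP.fromℚᵘ-cong {mkℚᵘ i n} {mkℚᵘ j d} (*≡* eq)

[q+i]/q≡1+i/q : ∀ q .{{_ : NonZero q}} i → (+ q + i) ℚ./ q ≡ 1ℚ ℚ.+ i ℚ./ q
[q+i]/q≡1+i/q (suc q) i = ℚP.toℚᵘ-injective (begin
  toℚᵘ ((+ suc q + i) ℚ./ suc q)       ≈⟨ ℚP.toℚᵘ-fromℚᵘ (mkℚᵘ (+ suc q + i) q) ⟩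
  mkℚᵘ (+ suc q + i) q                 ≈⟨ *≡* (trans (identity (+ suc q) i) (cong (λ t → (+ suc q + i) * + suc t) q≡q+0)) ⟨
  ℚᵘ.1ℚᵘ ℚᵘ.+ mkℚᵘ i q                  ≈⟨ ℚᵘP.+-congʳ ℚᵘ.1ℚᵘ (ℚP.toℚᵘ-fromℚᵘ (mkℚᵘ i q)) ⟨
  toℚᵘ 1ℚ ℚᵘ.+ toℚᵘ (i ℚ./ suc q)      ≈⟨ ℚP.toℚᵘ-homo-+ 1ℚ (i ℚ./ suc q) ⟨
  toℚᵘ (1ℚ ℚ.+ i ℚ./ suc q)            ∎)
  where
  open ℚᵘP.≃-Reasoning
  identity : ∀ Q i → (1ℤ * Q + i * 1ℤ) * Q ≡ (Q + i) * Q
  identity = solve-∀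
  q≡q+0 = sym (ℕP.+-identityʳ q)

eventually-constant⇒ConvergesTo : ∀ {a : ℕ → ℚ} {c} → (∀ ℓ → a (suc ℓ) ≡ c) → ConvergesTo a c
eventually-constant⇒ConvergesTo {a} {c} a≡c ε 0<ε = 1 , λ
  { (suc ℓ) _ → subst (λ t → ℚ.∣ t ℚ.- c ∣ ℚ.< ε) (sym (a≡c ℓ)) ∣c-c∣<ε }
  where ∣c-c∣<ε = subst (λ t → ℚ.∣ t ∣ ℚ.< ε) (sym (ℚP.+-inverseʳ c)) 0<ε

module _ (K : ℤ) {p′ : ℕ} (pp : Prime (suc p′)) where
  private
    p : ℕ
    p = suc p′

  σseq-suc : ∀ n → σseq K p pp (suc n) ≡ + (p′ ℕ.* suc p ℕ.+ #squareRoots K p) ℚ./ (p ℕ.* p)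
  σseq-suc n = /-cross {+ ν K (p ^ suc n)} {+ A} (p ^ (2 ℕ.* suc n)) (p ℕ.* p) {{ℕP.m^n≢0 p (2 ℕ.* suc n)}}
                       (pos-*≡pos-* {ν K (p ^ suc n)} {p ℕ.* p} {A} {p ^ (2 ℕ.* suc n)} cross-multiplied)
    where
    open ≡-Reasoning
    N = p ^ n
    A = p′ ℕ.* suc p ℕ.+ #squareRoots K p
    identity : ∀ N p A → N ℕ.* N ℕ.* A ℕ.* (p ℕ.* p) ≡ A ℕ.* (p ℕ.* N ℕ.* (p ℕ.* N))
    identity = ℕ-Ring.solve-∀
    p^2[1+n]≡[p*N]² : p ^ (2 ℕ.* suc n) ≡ p ℕ.* N ℕ.* (p ℕ.* N)
    p^2[1+n]≡[p*N]² = trans (cong (p ^_) (cong (suc n ℕ.+_) (ℕP.+-identityʳ (suc n))))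
                            (ℕP.^-distribˡ-+-* p (suc n) (suc n))
    cross-multiplied : ν K (p ^ suc n) ℕ.* (p ℕ.* p) ≡ A ℕ.* p ^ (2 ℕ.* suc n)
    cross-multiplied = begin
      ν K (p ^ suc n) ℕ.* (p ℕ.* p)    ≡⟨ cong (ℕ._* (p ℕ.* p)) (PrimePowerCount.ν-prime-power K pp n) ⟩
      N ℕ.* N ℕ.* A ℕ.* (p ℕ.* p)      ≡⟨ identity N p A ⟩
      A ℕ.* (p ℕ.* N ℕ.* (p ℕ.* N))    ≡⟨ cong (A ℕ.*_) p^2[1+n]≡[p*N]² ⟨
      A ℕ.* p ^ (2 ℕ.* suc n)          ∎

  σseq-limit : ∀ r i → + (p′ ℕ.* suc p ℕ.+ r) ≡ + (p ℕ.* p) + i → #squareRoots K p ≡ r →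
               ConvergesTo (σseq K p pp) (1ℚ ℚ.+ i ℚ./ (p ℕ.* p))
  σseq-limit r i r≡ #≡r = eventually-constant⇒ConvergesTo {σseq K p pp} λ n → begin
    σseq K p pp (suc n)                                  ≡⟨ σseq-suc n ⟩
    + (p′ ℕ.* suc p ℕ.+ #squareRoots K p) ℚ./ (p ℕ.* p)  ≡⟨ cong (λ t → + (p′ ℕ.* suc p ℕ.+ t) ℚ./ (p ℕ.* p)) #≡r ⟩
    + (p′ ℕ.* suc p ℕ.+ r) ℚ./ (p ℕ.* p)                 ≡⟨ cong (ℚ._/ (p ℕ.* p)) r≡ ⟩
    (+ (p ℕ.* p) + i) ℚ./ (p ℕ.* p)                      ≡⟨ [q+i]/q≡1+i/q (p ℕ.* p) i ⟩
    1ℚ ℚ.+ i ℚ./ (p ℕ.* p)                               ∎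
    where open ≡-Reasoning

  -- 1ℚ ℚ.- invSq p pp and 1ℚ ℚ.+ invSq p pp are 1ℚ ℚ.+ i ℚ./ (p ℕ.* p) for i = -1ℤ, 1ℤ by definition.
  σseq-nonresidue : LegendreView K p -1ℤ → ConvergesTo (σseq K p pp) (1ℚ ℚ.- invSq p pp)
  σseq-nonresidue view = σseq-limit 0 -1ℤ (cong +_ (identity p′)) (#squareRoots-nonresidue view)
    where identity : ∀ p′ → p′ ℕ.* suc (suc p′) ℕ.+ 0 ≡ p′ ℕ.+ p′ ℕ.* suc p′
          identity = ℕ-Ring.solve-∀

  σseq-residue : 2 ℕ.< p → LegendreView K p 1ℤ → ConvergesTo (σseq K p pp) (1ℚ ℚ.+ invSq p pp)
  σseq-residue 2<p view = σseq-limit 2 1ℤ (cong +_ (identity p′)) (#squareRoots-residue pp 2<p view)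
    where identity : ∀ p′ → p′ ℕ.* suc (suc p′) ℕ.+ 2 ≡ suc p′ ℕ.* suc p′ ℕ.+ 1
          identity = ℕ-Ring.solve-∀

  σseq-one-root : #squareRoots K p ≡ 1 → ConvergesTo (σseq K p pp) 1ℚ
  σseq-one-root #≡1 = subst (ConvergesTo (σseq K p pp)) 1+0/q≡1 (σseq-limit 1 0ℤ (cong +_ (identity p′)) #≡1)
    where
    identity : ∀ p′ → p′ ℕ.* suc (suc p′) ℕ.+ 1 ≡ suc p′ ℕ.* suc p′ ℕ.+ 0
    identity = ℕ-Ring.solve-∀
    1+0/q≡1 : 1ℚ ℚ.+ 0ℤ ℚ./ (p ℕ.* p) ≡ 1ℚ
    1+0/q≡1 = trans (cong (1ℚ ℚ.+_) (ℚP.0/n≡0 (p ℕ.* p))) (ℚP.+-identityʳ 1ℚ)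

lemma9p2 : (k : ℕ) → 1 ℕ.< k → SquareFree k → (p : ℕ) → (pp : Prime p) →
    ((2 ℕ.< p → legendre (+ k) p ≡ -1ℤ → ConvergesTo (σseq (+ k) p pp) (1ℚ ℚ.- invSq p pp))
    × (2 ℕ.< p → legendre (+ k) p ≡ 1ℤ → ConvergesTo (σseq (+ k) p pp) (1ℚ ℚ.+ invSq p pp))
    × (p ℕ∣.∣ 2 ℕ.* k → ConvergesTo (σseq (+ k) p pp) 1ℚ))
lemma9p2 k _ _ zero     pp = ⊥-elim (¬prime[0] pp)
lemma9p2 k _ _ (suc p′) pp =
    (λ _ → σseq-nonresidue (+ k) pp ∘ legendre≡⇒view)
  , (λ 2<p → σseq-residue (+ k) pp 2<p ∘ legendre≡⇒view)
  , σseq-one-root (+ k) pp ∘ #squareRoots-p∣2k {k = k} pp
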